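{- Let $\mathcal{T}$ be a theory over a one-sorted first-order signature $\Sigma$. If $\mathcal{T}$ is strongly finitely witnessable, then for every $\mathcal{T}$-satisfiable quantifier-free $\Sigma$-formula $\phi$, $\mu(\mathcal{T},\phi)$ is well-defined and equal to $0$ or $1$.
   Context: Interpretations have non-empty domains and assign values to all variables; a theory is the class of all interpretations satisfying a given set of sentences. $\mathrm{Spec}(\mathcal{T},\phi)$ is the set of finite cardinalities of domains of $\mathcal{T}$-interpretations satisfying $\phi$; $\mu(\mathcal{T},\phi)=\lim_{n\to\infty}|\mathrm{Spec}(\mathcal{T},\phi)\cap\{1,\dots,n\}|/n$ when the limit exists. For a finite set of variables $V$ and an equivalence $E$ on $V$, the arrangement $\delta_V^E$ is $\bigwedge_{xEy}(x=y)\wedge\bigwedge_{\neg(xEy)}\neg(x=y)$. $\mathcal{T}$ is strongly finitely witnessable if there is a computable function $wit$ from quantifier-free formulas to quantifier-free formulas such that for every quantifier-free $\phi$: (I) $\phi$ and $\exists\vec{x}\,wit(\phi)$ are $\mathcal{T}$-equivalent, where $\vec{x}=vars(wit(\phi))\setminus vars(\phi)$; (II*) for every finite set of variables $V$ and arrangement $\delta_V$ on $V$, if $wit(\phi)\wedge\delta_V$ is $\mathcal{T}$-satisfiable, some $\mathcal{T}$-interpretation $\mathcal{A}$ satisfies it with domain equal to the set of values in $\mathcal{A}$ of the variables of $wit(\phi)\wedge\delta_V$. -}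

module Defs where

open import Level using (0ℓ) renaming (suc to lsuc)
open import Data.Nat as ℕ using (ℕ; zero; suc; _≤_; _≟_)
open import Data.Fin using (Fin)
open import Data.Vec using (Vec; []; _∷_)
open import Data.List using (List; []; _∷_; _++_; filter; concatMap; foldr; length; map)
open import Data.List.Membership.Propositional using (_∈_)
open import Data.List.Membership.DecPropositional _≟_ using (_∈?_)
open import Data.List.Relation.Unary.All using (All)
open import Data.List.Relation.Unary.Unique.Propositional using (Unique)
open import Data.Product using (Σ; ∃; _×_; _,_; proj₁)
open import Data.Sum using (_⊎_)
open import Data.Empty using (⊥)
open import Data.Unit using (⊤)
open import Data.Bool using (if_then_else_)
open import Relation.Nullary using (¬_; ¬?)
open import Relation.Nullary.Decidable using (⌊_⌋)
open import Relation.Binary using (Rel; Decidable; IsDecEquivalence)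
open import Relation.Binary.PropositionalEquality using (_≡_)
open import Function.Bundles using (_↔_; _⇔_)
open import Data.Integer as ℤ using (ℤ)
open import Data.Rational as ℚ using (ℚ; _<_; _+_; _-_; _/_)

-- A one-sorted first-order signature (equality is a logical symbol).
record Signature : Set₁ where
  field
    FunSym    : Set
    funArity  : FunSym → ℕ
    PredSym   : Set
    predArity : PredSym → ℕ

module FOL (Sig : Signature) where
  open Signature Sig

  data Term : Set where
    var : ℕ → Term
    app : (f : FunSym) → Vec Term (funArity f) → Term

  data Formula : Set where
    ⊤ᶠ ⊥ᶠ   : Formula
    _≐_     : Term → Term → Formula
    rel     : (p : PredSym) → Vec Term (predArity p) → Formula
    ¬ᶠ_     : Formula → Formula
    _∧ᶠ_    : Formula → Formula → Formula
    _∨ᶠ_    : Formula → Formula → Formula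
    ∃ᶠ      : ℕ → Formula → Formula
    ∀ᶠ      : ℕ → Formula → Formula

  data IsQF : Formula → Set where
    ⊤-qf  : IsQF ⊤ᶠ
    ⊥-qf  : IsQF ⊥ᶠ
    ≐-qf  : ∀ s t → IsQF (s ≐ t)
    rel-qf : ∀ p ts → IsQF (rel p ts)
    ¬-qf  : ∀ {φ} → IsQF φ → IsQF (¬ᶠ φ)
    ∧-qf  : ∀ {φ ψ} → IsQF φ → IsQF ψ → IsQF (φ ∧ᶠ ψ)
    ∨-qf  : ∀ {φ ψ} → IsQF φ → IsQF ψ → IsQF (φ ∨ᶠ ψ)

  QFFormula : Set
  QFFormula = Σ Formula IsQF

  mutual
    termVars : Term → List ℕ
    termVars (var x) = x ∷ []
    termVars (app f ts) = termsVars ts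

    termsVars : ∀ {n} → Vec Term n → List ℕ
    termsVars [] = []
    termsVars (t ∷ ts) = termVars t ++ termsVars ts

  vars : Formula → List ℕ
  vars ⊤ᶠ = []
  vars ⊥ᶠ = []
  vars (s ≐ t) = termVars s ++ termVars t
  vars (rel p ts) = termsVars ts
  vars (¬ᶠ φ) = vars φ
  vars (φ ∧ᶠ ψ) = vars φ ++ vars ψ
  vars (φ ∨ᶠ ψ) = vars φ ++ vars ψ
  vars (∃ᶠ x φ) = filter (λ y → ¬? (y ≟ x)) (vars φ)
  vars (∀ᶠ x φ) = filter (λ y → ¬? (y ≟ x)) (vars φ)

  _∖_ : List ℕ → List ℕ → List ℕ
  xs ∖ ys = filter (λ x → ¬? (x ∈? ys)) xs

  existsClosure : List ℕ → Formula → Formula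
  existsClosure xs φ = foldr ∃ᶠ φ xs

  -- interpretations: non-empty domain (guaranteed by val), symbols, and
  -- values of all variables
  record Interp : Set₁ where
    field
      Dom   : Set
      funI  : (f : FunSym) → Vec Dom (funArity f) → Dom
      predI : (p : PredSym) → Vec Dom (predArity p) → Set
      val   : ℕ → Dom

  open Interp

  _[_↦_] : (A : Interp) → ℕ → Dom A → Interp
  A [ x ↦ d ] = record
    { Dom = Dom A ; funI = funI A ; predI = predI A
    ; val = λ y → if ⌊ y ≟ x ⌋ then d else val A y }

  mutual
    evalT : (A : Interp) → Term → Dom A
    evalT A (var x) = val A x
    evalT A (app f ts) = funI A f (evalTs A ts)

    evalTs : (A : Interp) → ∀ {n} → Vec Term n → Vec (Dom A) n
    evalTs A [] = []
    evalTs A (t ∷ ts) = evalT A t ∷ evalTs A ts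

  _⊨_ : Interp → Formula → Set
  A ⊨ ⊤ᶠ = ⊤
  A ⊨ ⊥ᶠ = ⊥
  A ⊨ (s ≐ t) = evalT A s ≡ evalT A t
  A ⊨ rel p ts = predI A p (evalTs A ts)
  A ⊨ (¬ᶠ φ) = ¬ (A ⊨ φ)
  A ⊨ (φ ∧ᶠ ψ) = (A ⊨ φ) × (A ⊨ ψ)
  A ⊨ (φ ∨ᶠ ψ) = (A ⊨ φ) ⊎ (A ⊨ ψ)
  A ⊨ ∃ᶠ x φ = Σ (Dom A) λ d → (A [ x ↦ d ]) ⊨ φ
  A ⊨ ∀ᶠ x φ = (d : Dom A) → (A [ x ↦ d ]) ⊨ φ

  record Theory : Set₁ where
    field
      Ax          : Formula → Set
      axSentences : ∀ ψ → Ax ψ → vars ψ ≡ []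

  TInterp : Theory → Interp → Set
  TInterp T A = ∀ ψ → Theory.Ax T ψ → A ⊨ ψ

  TSat : Theory → Formula → Set₁
  TSat T φ = ∃ λ A → TInterp T A × A ⊨ φ

  TEquiv : Theory → Formula → Formula → Set₁
  TEquiv T φ ψ = ∀ A → TInterp T A → (A ⊨ φ) ⇔ (A ⊨ ψ)

  conj : List Formula → Formula
  conj = foldr _∧ᶠ_ ⊤ᶠ

  arrangement : (V : List ℕ) {E : Rel ℕ 0ℓ} → Decidable E → Formula
  arrangement V E? =
    conj (concatMap (λ x → map (λ y → lit x y) V) V)
    where
    lit : ℕ → ℕ → Formula
    lit x y = if ⌊ E? x y ⌋ then (var x ≐ var y) else (¬ᶠ (var x ≐ var y))

  StronglyFinitelyWitnessable : Theory → Set₁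
  StronglyFinitelyWitnessable T =
    Σ (QFFormula → QFFormula) λ wit →
      (∀ φ → TEquiv T (proj₁ φ)
                (existsClosure (vars (proj₁ (wit φ)) ∖ vars (proj₁ φ)) (proj₁ (wit φ))))
      ×
      (∀ φ (V : List ℕ) (E : Rel ℕ 0ℓ) (isDE : IsDecEquivalence E) →
        let ψ = proj₁ (wit φ) ∧ᶠ arrangement V (IsDecEquivalence._≟_ isDE) in
        TSat T ψ →
        ∃ λ A → TInterp T A × A ⊨ ψ ×
          (∀ (d : Dom A) → ∃ λ x → x ∈ vars ψ × val A x ≡ d))

  Spec : Theory → Formula → ℕ → Set₁
  Spec T φ n = ∃ λ A → TInterp T A × A ⊨ φ × (Dom A ↔ Fin n)

DistinctIn : (S : ℕ → Set₁) → ℕ → List ℕ → Set₁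
DistinctIn S n L = Unique L × All (λ k → 1 ≤ k × k ≤ n × S k) L

-- lim_{n→∞} |S ∩ {1,…,n}| / n exists and equals r.
-- "|S ∩ {1..n}|/n < r+ε"  : every list of distinct members has ratio < r+ε;
-- "|S ∩ {1..n}|/n > r-ε"  : some list of distinct members has ratio > r-ε.
HasDensity : (S : ℕ → Set₁) → ℚ → Set₁
HasDensity S r =
  ∀ (ε : ℚ) → ℚ.0ℚ < ε → ∃ λ (N : ℕ) → ∀ (n : ℕ) → N ≤ n →
    (∀ L → DistinctIn S (suc n) L → (ℤ.+ length L) / suc n < r + ε)
    × (∃ λ L → DistinctIn S (suc n) L × r - ε < (ℤ.+ length L) / suc n)

{-# OPTIONS --safe #-}
module Submission where

-- Either the T-models of φ have bounded size, and then Spec(T, φ) is bounded and has density 0,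
-- or φ has arbitrarily large T-models, and then every n ≥ |vars(wit φ)| lies in the spectrum:
-- take a model with at least n + |vars(wit φ)| elements and a valuation satisfying wit φ, enlarge
-- the values of vars(wit φ) to exactly n distinct elements named by fresh variables, and apply (II*)
-- to wit φ together with the arrangement realised by all these variables.  The model it returns is
-- generated by the variables, which fall into exactly n classes of that arrangement.  A cofinite set
-- has density 1.

open import Defs
open import Level using (Level; 0ℓ; Lift; lift) renaming (suc to lsuc)
open import Axiom.ExcludedMiddle using (ExcludedMiddle)
open import Data.Bool using (true; false; if_then_else_)
open import Data.Fin using (Fin; zero; suc)
open import Data.Fin.Properties using (injective⇒≤)
open import Data.Integer as ℤ using (ℤ; +_; -[1+_]; +<+; +≤+)
import Data.Integer.Properties as ℤ
open import Data.Integer.Tactic.RingSolver using (solve-∀)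
open import Data.List
  using (List; []; _∷_; _++_; length; lookup; map; concatMap; filter; take; deduplicate; applyUpTo; tabulate)
open import Data.List.Extrema.Nat using (max; xs≤max)
open import Data.List.Properties
  using (length-map; length-++; length-take; length-deduplicate; length-applyUpTo; length-tabulate; map-cong-local)
open import Data.List.Membership.Propositional using (_∈_)
open import Data.List.Membership.Propositional.Properties
  using (∈-lookup; ∈-map⁺; ∈-map⁻; ∈-++⁺ˡ; ∈-++⁺ʳ; ∈-++⁻; ∈-filter⁺; ∈-filter⁻;
         ∈-deduplicate⁺; ∈-deduplicate⁻; ∈-applyUpTo⁺)
open import Data.List.Relation.Binary.Subset.Propositional using (_⊆_)
open import Data.List.Relation.Unary.All as All using (All; []; _∷_)
import Data.List.Relation.Unary.All.Properties as All
open import Data.List.Relation.Unary.AllPairs using ([]; _∷_)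
open import Data.List.Relation.Unary.Any using (here; there; index)
open import Data.List.Relation.Unary.Any.Properties using (lookup-index)
open import Data.List.Relation.Unary.Unique.Propositional using (Unique)
import Data.List.Relation.Unary.Unique.Propositional.Properties as Unique
open import Data.List.Relation.Unary.Unique.DecPropositional.Properties using (deduplicate-!)
open import Data.Nat as ℕ using (ℕ; zero; suc; _+_; _*_; _∸_; _⊓_; _≤_; _<_; s≤s; _≟_)
import Data.Nat.Properties as ℕ
open import Data.Product using (∃; ∃₂; _×_; _,_; proj₁; proj₂; map₁; map₂)
open import Data.Rational as ℚ using (mkℚ; 0ℚ; 1ℚ; _/_; toℚᵘ)
open import Data.Rational.Properties
  using (toℚᵘ-fromℚᵘ; toℚᵘ-cancel-<; toℚᵘ-cancel-≤; toℚᵘ-homo-+; toℚᵘ-homo‿-; 0/n≡0;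
         +-identityˡ; +-identityʳ; +-monoʳ-<; neg-antimono-<; ≤-<-trans)
open import Data.Rational.Unnormalised as ℚᵘ using (mkℚᵘ; 1ℚᵘ)
  renaming (_≃_ to _≃ᵘ_; _<_ to _<ᵘ_)
import Data.Rational.Unnormalised.Properties as ℚᵘ
open import Data.Sum using (_⊎_; inj₁; inj₂; [_,_]′)
open import Data.Unit using (tt)
open import Data.Vec using (Vec; []; _∷_)
open import Function using (_∘_; _on_; id)
open import Function.Bundles using (_⇔_; _↔_; mk⇔; mk↔ₛ′; Equivalence; Injection)
open import Function.Definitions using (Injective)
open import Function.Properties.Inverse using (↔-sym; ↔⇒↣)
open import Relation.Binary using (Rel; Decidable; IsDecEquivalence; DecidableEquality)
import Relation.Binary.Construct.On as On
open import Relation.Binary.PropositionalEquality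
import Relation.Binary.PropositionalEquality.Properties as ≡
open import Relation.Nullary using (¬_; ¬?; yes; no; does; contradiction)
open import Relation.Nullary.Decidable using (⌊_⌋; map′; decidable-stable)
open import Relation.Unary using (Pred) renaming (Decidable to Decidable₁)
open import Relation.Unary.Properties using (∁?)

module _ {A : Set} where

  Unique⇒lookup-injective : {xs : List A} → Unique xs → Injective _≡_ _≡_ (lookup xs)
  Unique⇒lookup-injective (_ ∷ _)  {zero}  {zero}  _  = refl
  Unique⇒lookup-injective (x∉ ∷ _) {zero}  {suc j} eq = contradiction eq (All.lookup x∉ (∈-lookup j))
  Unique⇒lookup-injective (x∉ ∷ _) {suc i} {zero}  eq = contradiction (sym eq) (All.lookup x∉ (∈-lookup i))
  Unique⇒lookup-injective (_ ∷ u)  {suc i} {suc j} eq = cong suc (Unique⇒lookup-injective u eq)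

  Unique-⊆⇒length≤ : {xs ys : List A} → Unique xs → xs ⊆ ys → length xs ≤ length ys
  Unique-⊆⇒length≤ {xs} {ys} u xs⊆ys = injective⇒≤ embed-injective
    where
    embed : Fin (length xs) → Fin (length ys)
    embed i = index (xs⊆ys (∈-lookup i))

    embed-injective : Injective _≡_ _≡_ embed
    embed-injective {i} {j} eq = Unique⇒lookup-injective u (begin
      lookup xs i          ≡⟨ lookup-index (xs⊆ys (∈-lookup i)) ⟩
      lookup ys (embed i)  ≡⟨ cong (lookup ys) eq ⟩
      lookup ys (embed j)  ≡⟨ lookup-index (xs⊆ys (∈-lookup j)) ⟨
      lookup xs j          ∎)
      where open ≡-Reasoning

  Unique-complete⇒↔Fin : {xs : List A} → Unique xs → (∀ x → x ∈ xs) → A ↔ Fin (length xs)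
  Unique-complete⇒↔Fin {xs} u complete = mk↔ₛ′ (index ∘ complete) (lookup xs)
    (λ i → Unique⇒lookup-injective u (sym (lookup-index (complete (lookup xs i)))))
    (λ x → sym (lookup-index (complete x)))

  Unique-map-reflect : {B C : Set} {f : A → B} {g : A → C} {xs : List A} →
                       (∀ {a b} → a ∈ xs → b ∈ xs → g a ≡ g b → f a ≡ f b) →
                       Unique (map f xs) → Unique (map g xs)
  Unique-map-reflect {xs = []}     _       []        = []
  Unique-map-reflect {xs = x ∷ xs} reflect (fx∉ ∷ u) =
    All.map⁺ (All.tabulate λ b∈ gx≡gb →
      All.lookup (All.map⁻ fx∉) b∈ (reflect (here refl) (there b∈) gx≡gb))
    ∷ Unique-map-reflect (λ a∈ b∈ → reflect (there a∈) (there b∈)) u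

  length-filter+∁ : {ℓ : Level} {P : Pred A ℓ} (P? : Decidable₁ P) (xs : List A) →
                    length xs ≡ length (filter P? xs) + length (filter (∁? P?) xs)
  length-filter+∁ P? []       = refl
  length-filter+∁ P? (x ∷ xs) with does (P? x)
  ... | true  = cong suc (length-filter+∁ P? xs)
  ... | false = trans (cong suc (length-filter+∁ P? xs)) (sym (ℕ.+-suc _ _))

transversal⇒↔Fin : {A B C : Set} (f : A → B) (g : A → C) {V Z : List A} →
                   (∀ {x y} → x ∈ V → y ∈ V → g x ≡ g y ⇔ f x ≡ f y) →
                   (∀ b → ∃ λ x → x ∈ V × f x ≡ b) →
                   Z ⊆ V → Unique (map g Z) → (∀ {x} → x ∈ V → g x ∈ map g Z) →
                   B ↔ Fin (length Z)
transversal⇒↔Fin {B = B} f g {V} {Z} same-kernel onto Z⊆V unique-g transversal =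
  subst (λ k → B ↔ Fin k) (length-map f Z) (Unique-complete⇒↔Fin unique-f complete)
  where
  unique-f : Unique (map f Z)
  unique-f = Unique-map-reflect (λ a∈Z b∈Z → Equivalence.from (same-kernel (Z⊆V a∈Z) (Z⊆V b∈Z))) unique-g

  complete : ∀ b → b ∈ map f Z
  complete b with x , x∈V , refl ← onto b with z , z∈Z , gx≡gz ← ∈-map⁻ g (transversal x∈V) =
    subst (_∈ map f Z) (sym (Equivalence.to (same-kernel x∈V (Z⊆V z∈Z)) gx≡gz)) (∈-map⁺ f z∈Z)

module _ {A : Set} (_≟ᴬ_ : DecidableEquality A) where
  open import Data.List.Membership.DecPropositional _≟ᴬ_ using (_∈?_; _∉?_)

  Unique⇒length≤length+∉ : {ys : List A} (xs : List A) → Unique ys →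
                           length ys ≤ length xs + length (filter (_∉? xs) ys)
  Unique⇒length≤length+∉ {ys} xs u = begin
    length ys                                                 ≡⟨ length-filter+∁ (_∈? xs) ys ⟩
    length (filter (_∈? xs) ys) + length (filter (_∉? xs) ys) ≤⟨ ℕ.+-monoˡ-≤ _ common≤xs ⟩
    length xs + length (filter (_∉? xs) ys)                   ∎
    where
    open ℕ.≤-Reasoning
    common≤xs : length (filter (_∈? xs) ys) ≤ length xs
    common≤xs = Unique-⊆⇒length≤ (Unique.filter⁺ (_∈? xs) u) (proj₂ ∘ ∈-filter⁻ (_∈? xs) {xs = ys})

  unique-superlist : (xs ys : List A) {m : ℕ} (n : ℕ) → Unique ys →
                     length xs ≤ m → m ≤ n → n + m ≤ length ys →
                     ∃ λ ds → Unique ds × length ds ≡ n × xs ⊆ ds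
  unique-superlist xs ys {m} n u |xs|≤m m≤n n+m≤|ys| =
    rs ++ take j fs , unique , length-ds , ∈-++⁺ˡ ∘ ∈-deduplicate⁺ _≟ᴬ_
    where
    rs fs : List A
    rs = deduplicate _≟ᴬ_ xs
    fs = filter (_∉? xs) ys

    j : ℕ
    j = n ∸ length rs

    |rs|≤n : length rs ≤ n
    |rs|≤n = ℕ.≤-trans (length-deduplicate _≟ᴬ_ xs) (ℕ.≤-trans |xs|≤m m≤n)

    j≤|fs| : j ≤ length fs
    j≤|fs| = ℕ.≤-trans (ℕ.m∸n≤m n (length rs)) (ℕ.+-cancelˡ-≤ m n (length fs) (begin
      m + n                  ≡⟨ ℕ.+-comm m n ⟩
      n + m                  ≤⟨ n+m≤|ys| ⟩
      length ys              ≤⟨ Unique⇒length≤length+∉ xs u ⟩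
      length xs + length fs  ≤⟨ ℕ.+-monoˡ-≤ (length fs) |xs|≤m ⟩
      m + length fs          ∎))
      where open ℕ.≤-Reasoning

    length-ds : length (rs ++ take j fs) ≡ n
    length-ds = begin
      length (rs ++ take j fs)        ≡⟨ length-++ rs ⟩
      length rs + length (take j fs)  ≡⟨ cong (_+_ (length rs)) (length-take j fs) ⟩
      length rs + j ⊓ length fs       ≡⟨ cong (_+_ (length rs)) (ℕ.m≤n⇒m⊓n≡m j≤|fs|) ⟩
      length rs + j                   ≡⟨ ℕ.m+[n∸m]≡n |rs|≤n ⟩
      n                               ∎
      where open ≡-Reasoning

    unique : Unique (rs ++ take j fs)
    unique = Unique.++⁺ (deduplicate-! _≟ᴬ_ xs) (Unique.take⁺ j (Unique.filter⁺ _ u)) λ (d∈rs , d∈fs) →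
      All.lookup (All.take⁺ j (All.all-filter (_∉? xs) ys)) d∈fs (∈-deduplicate⁻ _≟ᴬ_ xs d∈rs)

em⇒decidableEquality : ExcludedMiddle (lsuc 0ℓ) → (D : Set) → DecidableEquality D
em⇒decidableEquality em D a b = map′ Lift.lower lift em

toℚᵘ-/suc : ∀ a n → toℚᵘ (+ a / suc n) ≃ᵘ mkℚᵘ (+ a) n
toℚᵘ-/suc a n = toℚᵘ-fromℚᵘ (mkℚᵘ (+ a) n)

positive⇒fraction : ∀ {ε} → 0ℚ ℚ.< ε → ∃₂ λ p q → toℚᵘ ε ≡ mkℚᵘ (+ suc p) q
positive⇒fraction {mkℚ (+ suc p) q _} _ = p , q , refl
positive⇒fraction {mkℚ (+ zero) _ _}  (ℚ.*<* (+<+ ()))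
positive⇒fraction {mkℚ -[1+ _ ] _ _}  (ℚ.*<* ())

fraction-< : ∀ {a b m n} → a * suc m < b * suc n → mkℚᵘ (+ a) n <ᵘ mkℚᵘ (+ b) m
fraction-< {a} {b} {m} {n} lt = ℚᵘ.*<* (subst₂ ℤ._<_ (ℤ.pos-* a (suc m)) (ℤ.pos-* b (suc n)) (+<+ lt))

/suc≤1 : ∀ a n → a ≤ suc n → + a / suc n ℚ.≤ 1ℚ
/suc≤1 a n a≤ = toℚᵘ-cancel-≤ (ℚᵘ.≤-respˡ-≃ (ℚᵘ.≃-sym (toℚᵘ-/suc a n))
  (ℚᵘ.*≤* (subst₂ ℤ._≤_ (ℤ.pos-* a 1) (ℤ.pos-* 1 (suc n))
    (+≤+ (subst₂ _≤_ (sym (ℕ.*-identityʳ a)) (sym (ℕ.*-identityˡ (suc n))) a≤)))))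

-- ε = (p+1)/(q+1) is at least 1/(q+1)
/suc<ε : ∀ {ε p q} a n → toℚᵘ ε ≡ mkℚᵘ (+ suc p) q → a * suc q ≤ n → + a / suc n ℚ.< ε
/suc<ε {ε} {p} {q} a n ε≡ aq≤n =
  toℚᵘ-cancel-< (ℚᵘ.<-respˡ-≃ (ℚᵘ.≃-sym (toℚᵘ-/suc a n))
    (subst (mkℚᵘ (+ a) n <ᵘ_) (sym ε≡) (fraction-< cross)))
  where
  cross : a * suc q < suc p * suc n
  cross = ℕ.<-≤-trans (s≤s aq≤n) (ℕ.m≤n*m (suc n) (suc p))

1-ε</suc : ∀ {ε p q} m c n → toℚᵘ ε ≡ mkℚᵘ (+ suc p) q → m + c ≡ suc n → c * suc q ≤ n →
           1ℚ ℚ.- ε ℚ.< + m / suc n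
1-ε</suc {ε} {p} {q} m c n ε≡ m+c≡ cq≤n =
  toℚᵘ-cancel-< (ℚᵘ.<-respˡ-≃ (ℚᵘ.≃-sym toℚᵘ-1-ε)
    (ℚᵘ.<-respʳ-≃ (ℚᵘ.≃-sym (toℚᵘ-/suc m n)) (ℚᵘ.*<* cross)))
  where
  toℚᵘ-1-ε : toℚᵘ (1ℚ ℚ.- ε) ≃ᵘ 1ℚᵘ ℚᵘ.+ mkℚᵘ -[1+ p ] q
  toℚᵘ-1-ε = ℚᵘ.≃-trans (toℚᵘ-homo-+ 1ℚ (ℚ.- ε))
    (ℚᵘ.+-congʳ 1ℚᵘ (subst (λ z → toℚᵘ (ℚ.- ε) ≃ᵘ ℚᵘ.- z) ε≡ (toℚᵘ-homo‿- ε)))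

  P Q M C R : ℤ
  P = + suc p
  Q = + suc q
  M = + m
  C = + c
  R = + 1 ℤ.* Q ℤ.+ ℤ.- P ℤ.* + 1

  N≡M+C : + suc n ≡ M ℤ.+ C
  N≡M+C = trans (cong +_ (sym m+c≡)) (ℤ.pos-+ m c)

  CQ<PN : C ℤ.* Q ℤ.< P ℤ.* (M ℤ.+ C)
  CQ<PN = subst₂ ℤ._<_ (ℤ.pos-* c (suc q)) (trans (ℤ.pos-* (suc p) (suc n)) (cong (P ℤ.*_) N≡M+C))
    (+<+ (ℕ.<-≤-trans (s≤s cq≤n) (ℕ.m≤n*m (suc n) (suc p))))

  expand : ∀ P Q M C →
           (+ 1 ℤ.* Q ℤ.+ ℤ.- P ℤ.* + 1) ℤ.* (M ℤ.+ C) ≡ M ℤ.* Q ℤ.+ (C ℤ.* Q ℤ.- P ℤ.* (M ℤ.+ C))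
  expand = solve-∀

  cross : R ℤ.* + suc n ℤ.< M ℤ.* + (1 * suc q)
  cross = begin-strict
    R ℤ.* + suc n                         ≡⟨ cong (R ℤ.*_) N≡M+C ⟩
    R ℤ.* (M ℤ.+ C)                       ≡⟨ expand P Q M C ⟩
    M ℤ.* Q ℤ.+ (C ℤ.* Q ℤ.- PN)          <⟨ ℤ.+-monoʳ-< (M ℤ.* Q) (ℤ.+-monoˡ-< (ℤ.- PN) CQ<PN) ⟩
    M ℤ.* Q ℤ.+ (PN ℤ.- PN)               ≡⟨ cong (λ z → M ℤ.* Q ℤ.+ z) (ℤ.+-inverseʳ PN) ⟩
    M ℤ.* Q ℤ.+ ℤ.0ℤ                      ≡⟨ ℤ.+-identityʳ (M ℤ.* Q) ⟩
    M ℤ.* Q                               ≡⟨ cong (λ k → M ℤ.* + k) (ℕ.*-identityˡ (suc q)) ⟨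
    M ℤ.* + (1 * suc q)                   ∎
    where
    open ℤ.≤-Reasoning
    PN : ℤ
    PN = P ℤ.* (M ℤ.+ C)

Unique⇒length≤bound : ∀ {L m} → Unique L → All (λ k → 1 ≤ k × k ≤ m) L → length L ≤ m
Unique⇒length≤bound {L} {m} u bounds =
  subst (length L ≤_) (length-applyUpTo suc m) (Unique-⊆⇒length≤ u (in-range ∘ All.lookup bounds))
  where
  in-range : ∀ {k} → 1 ≤ k × k ≤ m → k ∈ applyUpTo suc m
  in-range {suc i} (_ , i<m) = ∈-applyUpTo⁺ suc i<m

bounded⇒density0 : (S : ℕ → Set₁) (k : ℕ) → (∀ n → S n → n < k) → HasDensity S 0ℚ
bounded⇒density0 S k bounded ε 0<ε with p , q , ε≡ ← positive⇒fraction 0<ε =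
  k * suc q , λ n kq≤n → upper n kq≤n , [] , ([] , []) , lower n
  where
  upper : ∀ n → k * suc q ≤ n → ∀ L → DistinctIn S (suc n) L → + length L / suc n ℚ.< 0ℚ ℚ.+ ε
  upper n kq≤n L (u , members) = subst (_ ℚ.<_) (sym (+-identityˡ ε))
    (/suc<ε (length L) n ε≡ (ℕ.≤-trans (ℕ.*-monoˡ-≤ (suc q) |L|≤k) kq≤n))
    where
    |L|≤k : length L ≤ k
    |L|≤k = Unique⇒length≤bound u (All.map (λ (1≤x , _ , x∈S) → 1≤x , ℕ.<⇒≤ (bounded _ x∈S)) members)

  lower : ∀ n → 0ℚ ℚ.- ε ℚ.< + 0 / suc n
  lower n = subst₂ ℚ._<_ (sym (+-identityˡ (ℚ.- ε))) (sym (0/n≡0 (suc n))) (neg-antimono-< 0<ε)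

cofinite⇒density1 : (S : ℕ → Set₁) (c : ℕ) → (∀ n → c ≤ n → S n) → HasDensity S 1ℚ
cofinite⇒density1 S c cofinite ε 0<ε with p , q , ε≡ ← positive⇒fraction 0<ε =
  c * suc q , λ n cq≤n →
    upper n , interval n , (interval-unique n , interval-members n cq≤n) , lower n cq≤n
  where
  upper : ∀ n L → DistinctIn S (suc n) L → + length L / suc n ℚ.< 1ℚ ℚ.+ ε
  upper n L (u , members) = ≤-<-trans
    (/suc≤1 (length L) n (Unique⇒length≤bound u (All.map (λ (1≤x , x≤ , _) → 1≤x , x≤) members)))
    (subst (ℚ._< 1ℚ ℚ.+ ε) (+-identityʳ 1ℚ) (+-monoʳ-< 1ℚ 0<ε))

  c≤1+n : ∀ {n} → c * suc q ≤ n → c ≤ suc n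
  c≤1+n cq≤n = ℕ.≤-trans (ℕ.m≤m*n c (suc q)) (ℕ.m≤n⇒m≤1+n cq≤n)

  interval : ℕ → List ℕ
  interval n = applyUpTo (λ i → suc (c + i)) (suc n ∸ c)

  interval-unique : ∀ n → Unique (interval n)
  interval-unique n =
    Unique.applyUpTo⁺₁ _ _ (λ i<j _ → ℕ.<⇒≢ i<j ∘ ℕ.+-cancelˡ-≡ c _ _ ∘ ℕ.suc-injective)

  interval-members : ∀ n → c * suc q ≤ n → All (λ k → 1 ≤ k × k ≤ suc n × S k) (interval n)
  interval-members n cq≤n = All.applyUpTo⁺₁ _ _ λ {i} i< →
    s≤s ℕ.z≤n ,
    subst (suc (c + i) ≤_) (ℕ.m+[n∸m]≡n (c≤1+n cq≤n)) (ℕ.+-monoʳ-< c i<) ,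
    cofinite _ (ℕ.m≤n⇒m≤1+n (ℕ.m≤m+n c i))

  lower : ∀ n → c * suc q ≤ n → 1ℚ ℚ.- ε ℚ.< + length (interval n) / suc n
  lower n cq≤n = subst (λ k → 1ℚ ℚ.- ε ℚ.< + k / suc n) (sym (length-applyUpTo _ (suc n ∸ c)))
    (1-ε</suc (suc n ∸ c) c n ε≡ (ℕ.m∸n+n≡m (c≤1+n cq≤n)) cq≤n)

-- `withValuation A v [ x ↦ d ]` is definitionally `withValuation A (update v x d)`.
update : {D : Set} → (ℕ → D) → ℕ → D → ℕ → D
update v x d y = if ⌊ y ≟ x ⌋ then d else v y

update-≡ : {D : Set} (v : ℕ → D) (x : ℕ) (d : D) → update v x d x ≡ d
update-≡ v x d with x ≟ x
... | yes _   = refl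
... | no x≢x  = contradiction refl x≢x

update-≢ : {D : Set} (v : ℕ → D) {x y : ℕ} (d : D) → y ≢ x → update v x d y ≡ v y
update-≢ v {x} {y} d y≢x with y ≟ x
... | yes y≡x = contradiction y≡x y≢x
... | no _    = refl

update-agrees : {D : Set} {v w : ℕ → D} {x : ℕ} {d : D} (xs : List ℕ) →
                (∀ {y} → y ∈ filter (λ y → ¬? (y ≟ x)) xs → v y ≡ w y) →
                ∀ {y} → y ∈ xs → update v x d y ≡ update w x d y
update-agrees {x = x} xs v≡w {y} y∈xs with y ≟ x
... | yes _   = refl
... | no y≢x  = v≡w (∈-filter⁺ (λ y → ¬? (y ≟ x)) y∈xs y≢x)

module _ {D : Set} where

  freshVars : ℕ → List D → List ℕ
  freshVars k []       = []
  freshVars k (_ ∷ ds) = k ∷ freshVars (suc k) ds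

  assignFrom : ℕ → List D → (ℕ → D) → ℕ → D
  assignFrom k []       v = v
  assignFrom k (d ∷ ds) v = update (assignFrom (suc k) ds v) k d

  length-freshVars : ∀ k ds → length (freshVars k ds) ≡ length ds
  length-freshVars k []       = refl
  length-freshVars k (_ ∷ ds) = cong suc (length-freshVars (suc k) ds)

  freshVars-≥ : ∀ k ds → All (k ≤_) (freshVars k ds)
  freshVars-≥ k []       = []
  freshVars-≥ k (_ ∷ ds) = ℕ.≤-refl ∷ All.map ℕ.<⇒≤ (freshVars-≥ (suc k) ds)

  assignFrom-< : ∀ k ds v {x} → x < k → assignFrom k ds v x ≡ v x
  assignFrom-< k []       v x<k = refl
  assignFrom-< k (d ∷ ds) v x<k = trans (update-≢ (assignFrom (suc k) ds v) d (ℕ.<⇒≢ x<k))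
                                        (assignFrom-< (suc k) ds v (ℕ.m<n⇒m<1+n x<k))

  map-assignFrom-freshVars : ∀ k ds v → map (assignFrom k ds v) (freshVars k ds) ≡ ds
  map-assignFrom-freshVars k []       v = refl
  map-assignFrom-freshVars k (d ∷ ds) v = cong₂ _∷_ (update-≡ w k d) (begin
    map (update w k d) (freshVars (suc k) ds)  ≡⟨ map-cong-local later-unchanged ⟩
    map w (freshVars (suc k) ds)               ≡⟨ map-assignFrom-freshVars (suc k) ds v ⟩
    ds                                         ∎)
    where
    open ≡-Reasoning
    w : ℕ → D
    w = assignFrom (suc k) ds v

    later-unchanged : All (λ y → update w k d y ≡ w y) (freshVars (suc k) ds)
    later-unchanged = All.map (λ k<y → update-≢ w d (ℕ.>⇒≢ k<y)) (freshVars-≥ (suc k) ds)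

module _ {Sig : Signature} where
  open FOL Sig
  open Interp

  withValuation : (A : Interp) → (ℕ → Dom A) → Interp
  withValuation A v = record { Dom = Dom A ; funI = funI A ; predI = predI A ; val = v }

  module _ (A : Interp) where

    mutual
      evalT-coincidence : {v w : ℕ → Dom A} (t : Term) → (∀ {x} → x ∈ termVars t → v x ≡ w x) →
                          evalT (withValuation A v) t ≡ evalT (withValuation A w) t
      evalT-coincidence (var x)    v≡w = v≡w (here refl)
      evalT-coincidence (app f ts) v≡w = cong (funI A f) (evalTs-coincidence ts v≡w)

      evalTs-coincidence : {v w : ℕ → Dom A} {n : ℕ} (ts : Vec Term n) →
                           (∀ {x} → x ∈ termsVars ts → v x ≡ w x) →
                           evalTs (withValuation A v) ts ≡ evalTs (withValuation A w) ts
      evalTs-coincidence []       v≡w = refl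
      evalTs-coincidence (t ∷ ts) v≡w =
        cong₂ _∷_ (evalT-coincidence t (v≡w ∘ ∈-++⁺ˡ)) (evalTs-coincidence ts (v≡w ∘ ∈-++⁺ʳ (termVars t)))

    ⊨-coincidence : {v w : ℕ → Dom A} (φ : Formula) → (∀ {x} → x ∈ vars φ → v x ≡ w x) →
                    withValuation A v ⊨ φ → withValuation A w ⊨ φ
    ⊨-coincidence ⊤ᶠ         v≡w _ = tt
    ⊨-coincidence ⊥ᶠ         v≡w ()
    ⊨-coincidence (s ≐ t)    v≡w s≡t = trans (sym (evalT-coincidence s (v≡w ∘ ∈-++⁺ˡ)))
                                             (trans s≡t (evalT-coincidence t (v≡w ∘ ∈-++⁺ʳ (termVars s))))
    ⊨-coincidence (rel p ts) v≡w = subst (predI A p) (evalTs-coincidence ts v≡w)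
    ⊨-coincidence (¬ᶠ φ)     v≡w ¬φ = ¬φ ∘ ⊨-coincidence φ (sym ∘ v≡w)
    ⊨-coincidence (φ ∧ᶠ ψ)   v≡w (⊨φ , ⊨ψ) =
      ⊨-coincidence φ (v≡w ∘ ∈-++⁺ˡ) ⊨φ , ⊨-coincidence ψ (v≡w ∘ ∈-++⁺ʳ (vars φ)) ⊨ψ
    ⊨-coincidence (φ ∨ᶠ ψ)   v≡w (inj₁ ⊨φ) = inj₁ (⊨-coincidence φ (v≡w ∘ ∈-++⁺ˡ) ⊨φ)
    ⊨-coincidence (φ ∨ᶠ ψ)   v≡w (inj₂ ⊨ψ) = inj₂ (⊨-coincidence ψ (v≡w ∘ ∈-++⁺ʳ (vars φ)) ⊨ψ)
    ⊨-coincidence (∃ᶠ x φ)   v≡w (d , ⊨φ) = d , ⊨-coincidence φ (update-agrees (vars φ) v≡w) ⊨φ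
    ⊨-coincidence (∀ᶠ x φ)   v≡w ⊨φ d = ⊨-coincidence φ (update-agrees (vars φ) v≡w) (⊨φ d)

  TInterp-withValuation : (T : Theory) {A : Interp} (v : ℕ → Dom A) →
                          TInterp T A → TInterp T (withValuation A v)
  TInterp-withValuation T {A} v A⊨T ψ ax =
    ⊨-coincidence A ψ (λ x∈ψ → contradiction (subst (_ ∈_) (Theory.axSentences T ψ ax) x∈ψ) λ ())
                      (A⊨T ψ ax)

  existsClosure-elim : (A : Interp) (xs : List ℕ) (ψ : Formula) → A ⊨ existsClosure xs ψ →
                       ∃ λ v → withValuation A v ⊨ ψ
  existsClosure-elim A []       ψ ⊨ψ       = val A , ⊨ψ
  existsClosure-elim A (x ∷ xs) ψ (d , ⊨ψ) = existsClosure-elim (A [ x ↦ d ]) xs ψ ⊨ψ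

  existsClosure-intro : (A : Interp) (xs : List ℕ) (ψ : Formula) → A ⊨ ψ → A ⊨ existsClosure xs ψ
  existsClosure-intro A []       ψ ⊨ψ = ⊨ψ
  existsClosure-intro A (x ∷ xs) ψ ⊨ψ =
    val A x , existsClosure-intro (A [ x ↦ val A x ]) xs ψ
                (⊨-coincidence A ψ (λ {y} _ → sym (update-self y)) ⊨ψ)
    where
    update-self : ∀ y → update (val A) x (val A x) y ≡ val A y
    update-self y with y ≟ x
    ... | yes refl = refl
    ... | no _     = refl

  -- Definitionally equal to the local `lit` of `arrangement` in Defs.
  literal : {E : Rel ℕ 0ℓ} → Decidable E → ℕ → ℕ → Formula
  literal E? x y = if ⌊ E? x y ⌋ then (var x ≐ var y) else (¬ᶠ (var x ≐ var y))

  Realises : Interp → Rel ℕ 0ℓ → List ℕ → Set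
  Realises A E V = ∀ {x y} → x ∈ V → y ∈ V → E x y ⇔ (val A x ≡ val A y)

  module _ {A : Interp} {E : Rel ℕ 0ℓ} (E? : Decidable E) where

    ⊨-literal⁺ : ∀ {x y} → E x y ⇔ (val A x ≡ val A y) → A ⊨ literal E? x y
    ⊨-literal⁺ {x} {y} E⇔≡ with E? x y
    ... | yes e  = Equivalence.to E⇔≡ e
    ... | no ¬e  = ¬e ∘ Equivalence.from E⇔≡

    ⊨-literal⁻ : ∀ {x y} → A ⊨ literal E? x y → E x y ⇔ (val A x ≡ val A y)
    ⊨-literal⁻ {x} {y} ⊨lit with E? x y
    ... | yes e  = mk⇔ (λ _ → ⊨lit) (λ _ → e)
    ... | no ¬e  = mk⇔ (λ e → contradiction e ¬e) (λ x≡y → contradiction x≡y ⊨lit)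

  ⊨-conj⁺ : {A : Interp} {fs : List Formula} → All (A ⊨_) fs → A ⊨ conj fs
  ⊨-conj⁺ []         = tt
  ⊨-conj⁺ (⊨f ∷ ⊨fs) = ⊨f , ⊨-conj⁺ ⊨fs

  ⊨-conj⁻ : {A : Interp} (fs : List Formula) → A ⊨ conj fs → All (A ⊨_) fs
  ⊨-conj⁻ []       _          = []
  ⊨-conj⁻ (f ∷ fs) (⊨f , ⊨fs) = ⊨f ∷ ⊨-conj⁻ fs ⊨fs

  vars-conj : {V : List ℕ} {fs : List Formula} → All (λ f → vars f ⊆ V) fs → vars (conj fs) ⊆ V
  vars-conj {fs = []}    []            ()
  vars-conj {fs = f ∷ _} (f⊆V ∷ fs⊆V) z∈ = [ f⊆V , vars-conj fs⊆V ]′ (∈-++⁻ (vars f) z∈)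

  module _ {V : List ℕ} {E : Rel ℕ 0ℓ} (E? : Decidable E) where

    All-literals⁺ : {ℓ : Level} {P : Formula → Set ℓ} →
                    (∀ {x y} → x ∈ V → y ∈ V → P (literal E? x y)) →
                    All P (concatMap (λ x → map (literal E? x) V) V)
    All-literals⁺ P-lit =
      All.concat⁺ (All.map⁺ (All.tabulate λ x∈V → All.map⁺ (All.tabulate (P-lit x∈V))))

    ⊨-arrangement⁺ : {A : Interp} → Realises A E V → A ⊨ arrangement V E?
    ⊨-arrangement⁺ realises = ⊨-conj⁺ (All-literals⁺ λ x∈V y∈V → ⊨-literal⁺ E? (realises x∈V y∈V))

    ⊨-arrangement⁻ : {A : Interp} → A ⊨ arrangement V E? → Realises A E V
    ⊨-arrangement⁻ ⊨arr x∈V y∈V = ⊨-literal⁻ E?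
      (All.lookup (All.map⁻ (All.lookup (All.map⁻ (All.concat⁻ (⊨-conj⁻ _ ⊨arr))) x∈V)) y∈V)

    vars-arrangement : vars (arrangement V E?) ⊆ V
    vars-arrangement = vars-conj (All-literals⁺ vars-literal)
      where
      vars-literal : ∀ {x y} → x ∈ V → y ∈ V → vars (literal E? x y) ⊆ V
      vars-literal {x} {y} x∈V y∈V with ⌊ E? x y ⌋
      ... | true  = λ { (here refl) → x∈V ; (there (here refl)) → y∈V }
      ... | false = λ { (here refl) → x∈V ; (there (here refl)) → y∈V }

  HasModelOfSize≥ : Theory → Formula → ℕ → Set₁
  HasModelOfSize≥ T φ m =
    ∃ λ A → TInterp T A × A ⊨ φ × ∃ λ (ds : List (Dom A)) → Unique ds × m ≤ length ds

  Spec⇒HasModelOfSize≥ : {T : Theory} {φ : Formula} {m n : ℕ} →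
                         Spec T φ n → m ≤ n → HasModelOfSize≥ T φ m
  Spec⇒HasModelOfSize≥ {m = m} (A , A⊨T , A⊨φ , Dom↔Fin) m≤n =
    A , A⊨T , A⊨φ , tabulate to , Unique.tabulate⁺ injective , subst (m ≤_) (sym (length-tabulate to)) m≤n
    where open Injection (↔⇒↣ (↔-sym Dom↔Fin))

module _ {Sig : Signature} (T : FOL.Theory Sig) (sfw : FOL.StronglyFinitelyWitnessable Sig T)
         (φ : FOL.QFFormula Sig) where
  open FOL Sig
  open Interp

  witφ : Formula
  witφ = proj₁ (proj₁ sfw φ)

  witnessVars : List ℕ
  witnessVars = vars witφ ∖ vars (proj₁ φ)

  φ⇔∃witφ : TEquiv T (proj₁ φ) (existsClosure witnessVars witφ)
  φ⇔∃witφ = proj₁ (proj₂ sfw) φ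

  witness-valuation : {A : Interp} → TInterp T A → A ⊨ proj₁ φ → ∃ λ v → withValuation A v ⊨ witφ
  witness-valuation {A} A⊨T A⊨φ =
    existsClosure-elim A witnessVars witφ (Equivalence.to (φ⇔∃witφ A A⊨T) A⊨φ)

  generated-model : (A : Interp) → TInterp T A → DecidableEquality (Dom A) →
                    (u : ℕ → Dom A) → withValuation A u ⊨ witφ → (V : List ℕ) → vars witφ ⊆ V →
                    ∃ λ A′ → TInterp T A′ × A′ ⊨ proj₁ φ × Realises A′ (_≡_ on u) V ×
                             (∀ d → ∃ λ x → x ∈ V × val A′ x ≡ d)
  generated-model A A⊨T _≟ᴬ_ u u⊨witφ V witφ⊆V =
    let A′ , A′⊨T , (A′⊨witφ , A′⊨arr) , generated = proj₂ (proj₂ sfw) φ V (_≡_ on u) isDecE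
          (withValuation A u , TInterp-withValuation T u A⊨T , u⊨ψ)
    in A′ , A′⊨T ,
       Equivalence.from (φ⇔∃witφ A′ A′⊨T) (existsClosure-intro A′ witnessVars witφ A′⊨witφ) ,
       ⊨-arrangement⁻ E? A′⊨arr , map₂ (map₁ ψ⊆V) ∘ generated
    where
    isDecE : IsDecEquivalence (_≡_ on u)
    isDecE = On.isDecEquivalence u (≡.isDecEquivalence _≟ᴬ_)

    E? : Decidable (_≡_ on u)
    E? = IsDecEquivalence._≟_ isDecE

    u⊨ψ : withValuation A u ⊨ (witφ ∧ᶠ arrangement V E?)
    u⊨ψ = u⊨witφ , ⊨-arrangement⁺ {V = V} E? (λ _ _ → mk⇔ id id)

    ψ⊆V : vars (witφ ∧ᶠ arrangement V E?) ⊆ V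
    ψ⊆V = [ witφ⊆V , vars-arrangement E? ]′ ∘ ∈-++⁻ (vars witφ)

  spec-from-witness : (A : Interp) → TInterp T A → DecidableEquality (Dom A) →
                      (v : ℕ → Dom A) → withValuation A v ⊨ witφ →
                      (ds : List (Dom A)) → Unique ds → map v (vars witφ) ⊆ ds →
                      Spec T (proj₁ φ) (length ds)
  spec-from-witness A A⊨T _≟ᴬ_ v v⊨witφ ds unique-ds v[W]⊆ds =
    let A′ , A′⊨T , A′⊨φ , realises , onto = generated-model A A⊨T _≟ᴬ_ u u⊨witφ (W ++ Z) ∈-++⁺ˡ
    in A′ , A′⊨T , A′⊨φ , subst (λ n → Dom A′ ↔ Fin n) (length-freshVars k ds)
         (transversal⇒↔Fin (val A′) u realises onto (∈-++⁺ʳ W) unique-u[Z] transversal)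
    where
    W : List ℕ
    W = vars witφ

    k : ℕ
    k = suc (max 0 W)

    Z : List ℕ
    Z = freshVars k ds

    u : ℕ → Dom A
    u = assignFrom k ds v

    u-on-W : ∀ {x} → x ∈ W → u x ≡ v x
    u-on-W x∈W = assignFrom-< k ds v (s≤s (All.lookup (xs≤max 0 W) x∈W))

    u[Z]≡ds : map u Z ≡ ds
    u[Z]≡ds = map-assignFrom-freshVars k ds v

    unique-u[Z] : Unique (map u Z)
    unique-u[Z] = subst Unique (sym u[Z]≡ds) unique-ds

    u⊨witφ : withValuation A u ⊨ witφ
    u⊨witφ = ⊨-coincidence A witφ (sym ∘ u-on-W) v⊨witφ

    transversal : ∀ {x} → x ∈ W ++ Z → u x ∈ map u Z
    transversal x∈V with ∈-++⁻ W x∈V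
    ... | inj₂ x∈Z = ∈-map⁺ u x∈Z
    ... | inj₁ x∈W = subst₂ _∈_ (sym (u-on-W x∈W)) (sym u[Z]≡ds) (v[W]⊆ds (∈-map⁺ v x∈W))

  spec-cofinite : ExcludedMiddle (lsuc 0ℓ) → (∀ m → HasModelOfSize≥ T (proj₁ φ) m) →
                  ∀ n → length (vars witφ) ≤ n → Spec T (proj₁ φ) n
  spec-cofinite em large n |W|≤n =
    let A , A⊨T , A⊨φ , ys , unique-ys , n+|W|≤|ys| = large (n + length (vars witφ))
        _≟ᴬ_ = em⇒decidableEquality em (Dom A)
        v , v⊨witφ = witness-valuation A⊨T A⊨φ
        ds , unique-ds , |ds|≡n , v[W]⊆ds = unique-superlist _≟ᴬ_ (map v (vars witφ)) ys n unique-ys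
          (ℕ.≤-reflexive (length-map v (vars witφ))) |W|≤n n+|W|≤|ys|
    in subst (Spec T (proj₁ φ)) |ds|≡n (spec-from-witness A A⊨T _≟ᴬ_ v v⊨witφ ds unique-ds v[W]⊆ds)

theorem10 : ExcludedMiddle (lsuc 0ℓ) →
    (Sig : Signature) (T : FOL.Theory Sig) →
    FOL.StronglyFinitelyWitnessable Sig T →
    (φ : FOL.QFFormula Sig) → FOL.TSat Sig T (proj₁ φ) →
    HasDensity (FOL.Spec Sig T (proj₁ φ)) 0ℚ ⊎ HasDensity (FOL.Spec Sig T (proj₁ φ)) 1ℚ
theorem10 em Sig T sfw φ _ with em {∃ λ m → ¬ HasModelOfSize≥ T (proj₁ φ) m}
... | yes (m , no-model≥m) =
  inj₁ (bounded⇒density0 _ m λ n n∈Spec →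
         ℕ.≰⇒> (no-model≥m ∘ Spec⇒HasModelOfSize≥ {T = T} {φ = proj₁ φ} n∈Spec))
... | no ¬∃ =
  inj₂ (cofinite⇒density1 _ _ (spec-cofinite T sfw φ em λ m → decidable-stable em (¬∃ ∘ (m ,_))))
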